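{- In the game $\mathcal{R}(K_{\aleph_0}^{(3)}, G)$ with $G=\hat{K}_{2,4}^{(3)}$, suppose that at some position of a play (in which nobody has won yet) $P_2$ has claimed a copy of $\hat{K}_{2,3}^{(3)}$, $P_1$ has claimed at most $10$ edges, and $P_1$ has no threat. If it is $P_2$'s turn, then $P_2$ has a drawing strategy from this position, i.e. a strategy guaranteeing that $P_1$ does not win.
   Context: Strong Ramsey game $\mathcal{R}(B,G)$: players $P_1$, $P_2$ alternately color uncolored edges of the $k$-uniform board $B$ in their own color, $P_1$ first; whoever first completes a monochromatic copy of the target $G$ in their own color wins; if nobody does in finitely many moves, it is a draw. $K_{\aleph_0}^{(3)}$ is the complete $3$-uniform hypergraph on countably many vertices. $\hat{K}_{2,l}$ is $K_{2,l}$ plus the edge joining its two vertices of degree $l$; for a graph $H$, $H^{(3)}$ is obtained by adding one fixed new vertex to every edge of $H$. So a copy of $\hat{K}_{2,3}^{(3)}$ consists of edges $cxy, cxu_i, cyu_i$ ($i=1,2,3$) for distinct vertices $c,x,y,u_1,u_2,u_3$. $P_1$ has a threat if she has claimed all edges of a copy of $G-e$ (for some edge $e$ of $G$) such that the board edge corresponding to $e$ is not yet claimed by either player. -}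

module Defs where

open import Data.Nat using (ℕ; zero; suc; _+_; _≤_)
open import Data.Fin using (Fin; zero; suc)
open import Data.Product using (Σ; ∃; _×_; _,_)
open import Data.Sum using (_⊎_)
open import Data.List using (List; []; _∷_; length; lookup; map; tabulate; _++_)
open import Data.List.Relation.Unary.Any using (Any)
open import Data.List.Relation.Unary.All using (All)
open import Data.List.Relation.Unary.AllPairs using (AllPairs)
open import Relation.Binary.PropositionalEquality using (_≡_; _≢_)
open import Relation.Nullary using (¬_)
open import Function.Definitions using (Injective)

-- The board K_{ℵ0}^{(3)}: vertices are natural numbers, an edge is a
-- 3-element set of vertices, represented by a triple of pairwise
-- distinct naturals; two triples denote the same edge iff they have the
-- same underlying set.

Edge : Set
Edge = ℕ × ℕ × ℕ

ValidEdge : Edge → Set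
ValidEdge (a , b , c) = (a ≢ b) × (a ≢ c) × (b ≢ c)

_∈₃_ : ℕ → Edge → Set
v ∈₃ (a , b , c) = (v ≡ a) ⊎ (v ≡ b) ⊎ (v ≡ c)

SameEdge : Edge → Edge → Set
SameEdge e f = (v : ℕ) → ((v ∈₃ e → v ∈₃ f) × (v ∈₃ f → v ∈₃ e))

_∈E_ : Edge → List Edge → Set
e ∈E S = Any (SameEdge e) S

_∉E_ : Edge → List Edge → Set
e ∉E S = ¬ (e ∈E S)

Graph : ℕ → Set
Graph n = List (Fin n × Fin n)

Hyper3 : ℕ → Set
Hyper3 n = List (Fin n × Fin n × Fin n)

-- H^{(3)}: add one new vertex (zero) to every edge of H
cone : {n : ℕ} → Graph n → Hyper3 (suc n)
cone H = map (λ { (u , v) → (zero , suc u , suc v) }) H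

-- \hat K_{2,l}: vertices 0,1 (degree l) and 2,…,l+1; edges {0,1},
-- {0,2+i}, {1,2+i}
KhatTwo : (l : ℕ) → Graph (2 + l)
KhatTwo l = (zero , suc zero)
  ∷ (tabulate (λ i → (zero , suc (suc i))) ++ tabulate (λ i → (suc zero , suc (suc i))))

KhatTwo3 : (l : ℕ) → Hyper3 (3 + l)
KhatTwo3 l = cone (KhatTwo l)

img : {n : ℕ} → (Fin n → ℕ) → Fin n × Fin n × Fin n → Edge
img φ (i , j , k) = (φ i , φ j , φ k)

-- S contains a copy of H (not necessarily induced)
HasCopy : {n : ℕ} → Hyper3 n → List Edge → Set
HasCopy {n} H S = Σ (Fin n → ℕ) λ φ → Injective _≡_ _≡_ φ × All (λ t → img φ t ∈E S) H

-- P1 (owning A) has a threat w.r.t. H, P2 owning B: a copy of H - e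
-- claimed by P1 whose missing edge e is unclaimed
Threat : {n : ℕ} → Hyper3 n → List Edge → List Edge → Set
Threat {n} H A B = Σ (Fin n → ℕ) λ φ → Injective _≡_ _≡_ φ × Σ (Fin (length H)) λ i →
  ((j : Fin (length H)) → j ≢ i → img φ (lookup H j) ∈E A)
  × img φ (lookup H i) ∉E A × img φ (lookup H i) ∉E B

WellFormed : List Edge → Set
WellFormed S = All ValidEdge S × AllPairs (λ e f → ¬ SameEdge e f) S

Disjoint : List Edge → List Edge → Set
Disjoint A B = All (λ e → e ∉E B) A

Legal : Edge → List Edge → List Edge → Set
Legal e A B = ValidEdge e × e ∉E A × e ∉E B

-- A strategy for P2: given P1's claimed edges and P2's claimed edges
-- (lists with most recent move first, hence encoding the history),
-- choose an edge.
StrategyP2 : Set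
StrategyP2 = List Edge → List Edge → Edge

data Reach {n : ℕ} (G : Hyper3 n) (σ : StrategyP2) (A₀ B₀ : List Edge)
     : List Edge → List Edge → Set where
  start : Reach G σ A₀ B₀ A₀ B₀
  step  : ∀ {A B} (f : Edge) → Reach G σ A₀ B₀ A B
        → ¬ HasCopy G (σ A B ∷ B)
        → Legal f A (σ A B ∷ B)
        → ¬ HasCopy G (f ∷ A)
        → Reach G σ A₀ B₀ (f ∷ A) (σ A B ∷ B)

DrawingStrategyP2 : {n : ℕ} → Hyper3 n → StrategyP2 → List Edge → List Edge → Set
DrawingStrategyP2 G σ A₀ B₀ = ∀ A B → Reach G σ A₀ B₀ A B →
  Legal (σ A B) A B ×
  (¬ HasCopy G (σ A B ∷ B) → (f : Edge) → Legal f A (σ A B ∷ B) → ¬ HasCopy G (f ∷ A))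

PositionP2ToMove : {n : ℕ} → Hyper3 n → List Edge → List Edge → Set
PositionP2ToMove G A B = WellFormed A × WellFormed B × Disjoint A B
  × length A ≡ suc (length B) × ¬ HasCopy G A × ¬ HasCopy G B

module Submission where

-- P2 owns a copy of K̂_{2,3}^{(3)} with apex c and hubs x, y, fixes an orientation (a, b) of {x, y},
-- and keeps claiming c a u for fresh vertices u. Each such edge threatens c b u, which would complete a
-- K̂_{2,4}^{(3)}, so P1 must answer c b u every time (otherwise P2 wins at once). Suppose a move g of P1
-- completes a K̂_{2,4}^{(3)}. A fresh vertex lies in at most two of P1's edges (g and c b u), while apex and
-- hubs have degree at least three, so only leaves can be fresh. If no leaf is fresh, every edge of the copy
-- other than g was claimed before, so g completed a threat P1 already had. Otherwise exactly one leaf is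
-- fresh, and deleting it leaves a K̂_{2,3}^{(3)} among P1's original edges whose apex and one hub are c and b,
-- avoiding a. That forces at least 4 original edges of P1 through c and b avoiding a, and 3 more avoiding a
-- and not through both c and b. This cannot hold for both orientations, as 4 + 4 + 3 > 10, and P2 chooses
-- an orientation for which it fails.

open import Data.Bool using (if_then_else_)
open import Data.Empty using (⊥; ⊥-elim)
open import Data.Fin using (Fin; zero; suc; toℕ; punchOut)
open import Data.Fin.Properties
  using (all?; any?; suc-injective; punchIn-injective; punchInᵢ≢i; punchOut-injective; pigeonhole)
import Data.Fin.Properties as Fin
open import Data.List using (List; []; _∷_; length; lookup; filter; _++_)
open import Data.List.Properties using (length-filter)
open import Data.List.Relation.Unary.All using (All; []; _∷_)
import Data.List.Relation.Unary.All as All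
open import Data.List.Relation.Unary.All.Properties using (map⁻; map⁺; ++⁺; ++⁻ˡ; ++⁻ʳ; tabulate⁻; tabulate⁺)
open import Data.List.Relation.Unary.Any using (here; there; index)
open import Data.List.Relation.Unary.Any.Properties using (lookup-index; ++⁺ˡ; ++⁺ʳ)
open import Data.List.Membership.Propositional.Properties using (∈-lookup)
open import Data.List.Membership.Setoid.Properties using (∈-resp-≈; ∈-filter⁺)
open import Data.Nat using (ℕ; zero; suc; _+_; _≤_; _<_; _≤?_; _<?_; s≤s; _∸_)
import Data.Nat as ℕ
open import Data.Nat.Properties
  using (≤-refl; ≤-trans; m≤m+n; m≤n+m; <⇒≢; <⇒≱; ≰⇒>; ≮⇒≥; +-suc; +-cancelˡ-≡; m+n∸n≡m; +-mono-≤; m≤n⇒m≤1+n; module ≤-Reasoning)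
open import Data.Product using (Σ; ∃; _×_; _,_; proj₁; proj₂)
open import Data.Sum using (_⊎_; inj₁; inj₂)
import Data.Sum as Sum
open import Data.Vec.Functional using (insertAt; removeAt)
open import Data.Vec.Functional.Properties using (insertAt-lookup; insertAt-punchIn; removeAt-punchOut)
open import Function using (_∘_)
open import Function.Definitions using (Injective)
open import Relation.Binary using (Setoid; DecSetoid; Decidable)
open import Relation.Binary.PropositionalEquality using (_≡_; _≢_; refl; sym; trans; cong; subst)
open import Relation.Nullary using (¬_; Dec; yes; no; does; contradiction)
open import Relation.Nullary.Decidable using (map′; _×-dec_; _⊎-dec_; _→-dec_; ¬?; toWitness; True)

open import Defs

pattern at₁ = inj₁ refl
pattern at₂ = inj₂ (inj₁ refl)
pattern at₃ = inj₂ (inj₂ refl)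

≈-refl : ∀ {e} → SameEdge e e
≈-refl v = (λ x → x) , (λ x → x)

≈-sym : ∀ {e f} → SameEdge e f → SameEdge f e
≈-sym e≈f v = proj₂ (e≈f v) , proj₁ (e≈f v)

≈-trans : ∀ {e f g} → SameEdge e f → SameEdge f g → SameEdge e g
≈-trans e≈f f≈g v = proj₁ (f≈g v) ∘ proj₁ (e≈f v) , proj₂ (e≈f v) ∘ proj₂ (f≈g v)

edgeSetoid : Setoid _ _
edgeSetoid = record
  { Carrier = Edge ; _≈_ = SameEdge
  ; isEquivalence = record { refl = ≈-refl ; sym = ≈-sym ; trans = ≈-trans } }

∈₃-resp : ∀ {v e f} → SameEdge e f → v ∈₃ e → v ∈₃ f
∈₃-resp {v} e≈f = proj₁ (e≈f v)

separatedBy : ∀ {v e f} → v ∈₃ e → ¬ v ∈₃ f → ¬ SameEdge e f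
separatedBy v∈e v∉f e≈f = v∉f (∈₃-resp e≈f v∈e)

_∈₃?_ : (v : ℕ) (e : Edge) → Dec (v ∈₃ e)
v ∈₃? (x , y , z) = v ℕ.≟ x ⊎-dec (v ℕ.≟ y ⊎-dec v ℕ.≟ z)

_⊆₃_ : Edge → Edge → Set
e ⊆₃ f = ∀ v → v ∈₃ e → v ∈₃ f

≈-intro : ∀ {e f} → e ⊆₃ f → f ⊆₃ e → SameEdge e f
≈-intro e⊆f f⊆e v = e⊆f v , f⊆e v

⊆₃-intro : ∀ {x y z f} → x ∈₃ f → y ∈₃ f → z ∈₃ f → (x , y , z) ⊆₃ f
⊆₃-intro x∈f y∈f z∈f _ at₁ = x∈f
⊆₃-intro x∈f y∈f z∈f _ at₂ = y∈f
⊆₃-intro x∈f y∈f z∈f _ at₃ = z∈f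

_⊆₃?_ : (e f : Edge) → Dec (e ⊆₃ f)
(x , y , z) ⊆₃? f = map′ (λ (x∈f , y∈f , z∈f) → ⊆₃-intro x∈f y∈f z∈f)
                         (λ e⊆f → e⊆f x at₁ , e⊆f y at₂ , e⊆f z at₃)
                         (x ∈₃? f ×-dec (y ∈₃? f ×-dec z ∈₃? f))

sameEdge? : Decidable SameEdge
sameEdge? e f =
  map′ (λ (e⊆f , f⊆e) → ≈-intro e⊆f f⊆e) (λ e≈f → proj₁ ∘ e≈f , proj₂ ∘ e≈f) (e ⊆₃? f ×-dec f ⊆₃? e)

∈E-resp : ∀ {e f S} → SameEdge e f → e ∈E S → f ∈E S
∈E-resp = ∈-resp-≈ edgeSetoid

edgeDecSetoid : DecSetoid _ _
edgeDecSetoid = record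
  { isDecEquivalence = record { isEquivalence = Setoid.isEquivalence edgeSetoid ; _≟_ = sameEdge? } }

open import Data.List.Membership.DecSetoid edgeDecSetoid using (_∈?_)

swap₁₂ : ∀ {x y z} → SameEdge (x , y , z) (y , x , z)
swap₁₂ = ≈-intro (⊆₃-intro at₂ at₁ at₃) (⊆₃-intro at₂ at₁ at₃)

swap₂₃ : ∀ {x y z} → SameEdge (x , y , z) (x , z , y)
swap₂₃ = ≈-intro (⊆₃-intro at₁ at₃ at₂) (⊆₃-intro at₁ at₃ at₂)

∈₃-img⁺ : ∀ {n} (φ : Fin n → ℕ) {x p q r} → x ≡ p ⊎ x ≡ q ⊎ x ≡ r → φ x ∈₃ img φ (p , q , r)
∈₃-img⁺ φ = Sum.map (cong φ) (Sum.map (cong φ) (cong φ))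

module _ {n : ℕ} {ψ : Fin n → ℕ} (ψ-inj : Injective _≡_ _≡_ ψ) where

  ∈₃-img⁻ : ∀ {x p q r} → ψ x ∈₃ img ψ (p , q , r) → x ≡ p ⊎ x ≡ q ⊎ x ≡ r
  ∈₃-img⁻ = Sum.map ψ-inj (Sum.map ψ-inj ψ-inj)

  ∉₃-img : ∀ {x p q r} → x ≢ p → x ≢ q → x ≢ r → ¬ ψ x ∈₃ img ψ (p , q , r)
  ∉₃-img x≢p x≢q x≢r = Sum.[ x≢p , Sum.[ x≢q , x≢r ] ] ∘ ∈₃-img⁻

  -- Injectivity of ψ makes s and t equal as vertex sets.
  ≈-img-transfer : ∀ {s t} (φ : Fin n → ℕ) → SameEdge (img ψ s) (img ψ t) → SameEdge (img φ s) (img φ t)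
  ≈-img-transfer φ s≈t = ≈-intro (along s≈t) (along (≈-sym s≈t))
    where
    along : ∀ {s t} → SameEdge (img ψ s) (img ψ t) → img φ s ⊆₃ img φ t
    along s≈t _ at₁ = ∈₃-img⁺ φ (∈₃-img⁻ (∈₃-resp s≈t at₁))
    along s≈t _ at₂ = ∈₃-img⁺ φ (∈₃-img⁻ (∈₃-resp s≈t at₂))
    along s≈t _ at₃ = ∈₃-img⁺ φ (∈₃-img⁻ (∈₃-resp s≈t at₃))

-- Vertex sets are compared through toℕ, so that Simple is decided by evaluation.
Simple : ∀ {n} → Hyper3 n → Set
Simple H = ∀ i j → i ≢ j → ¬ SameEdge (img toℕ (lookup H i)) (img toℕ (lookup H j))

simple? : ∀ {n} (H : Hyper3 n) → Dec (Simple H)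
simple? H = all? λ i → all? λ j → ¬? (i Fin.≟ j) →-dec ¬? (sameEdge? _ _)

MapsInto : ∀ {n} → Hyper3 n → (Fin n → ℕ) → List Edge → Set
MapsInto H ψ S = All (λ t → img ψ t ∈E S) H

All-lookup : ∀ {A : Set} {P : A → Set} {xs} → All P xs → ∀ i → P (lookup xs i)
All-lookup ps i = All.lookup ps (∈-lookup i)

All-fromLookup : ∀ {A : Set} {P : A → Set} xs → (∀ i → P (lookup xs i)) → All P xs
All-fromLookup []       _ = []
All-fromLookup (x ∷ xs) p = p zero ∷ All-fromLookup xs (p ∘ suc)

completion-is-threat : ∀ {n} {H : Hyper3 n} {ψ g A B} → Simple H → g ∉E A → g ∉E B →
  Injective _≡_ _≡_ ψ → MapsInto H ψ (g ∷ A) → HasCopy H A ⊎ Threat H A B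
completion-is-threat {H = H} {ψ} {g} {A} simple g∉A g∉B ψ-inj maps
  with any? (λ i → sameEdge? (img ψ (lookup H i)) g)
... | yes (i , i≈g) = inj₂ (ψ , ψ-inj , i , others , g∉A ∘ ∈E-resp i≈g , g∉B ∘ ∈E-resp i≈g)
  where
  others : ∀ j → j ≢ i → img ψ (lookup H j) ∈E A
  others j j≢i with All-lookup maps j
  ... | here j≈g  = ⊥-elim (simple j i j≢i (≈-img-transfer ψ-inj toℕ (≈-trans j≈g (≈-sym i≈g))))
  ... | there j∈A = j∈A
... | no none = inj₁ (ψ , ψ-inj , All-fromLookup H in-A)
  where
  in-A : ∀ i → img ψ (lookup H i) ∈E A
  in-A i with All-lookup maps i
  ... | here i≈g  = ⊥-elim (none (i , i≈g))
  ... | there i∈A = i∈A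

-- For concrete s and t the implicit proof is found by evaluation.
apart : ∀ {n} {ψ : Fin n → ℕ} → Injective _≡_ _≡_ ψ → ∀ s t →
  {True (¬? (sameEdge? (img toℕ s) (img toℕ t)))} → ¬ SameEdge (img ψ s) (img ψ t)
apart ψ-inj s t {s≉t} = toWitness s≉t ∘ ≈-img-transfer ψ-inj toℕ

-- The hypergraphs K̂_{2,l}^{(3)}

module _ {l : ℕ} where

  apex hub₁ hub₂ : Fin (3 + l)
  apex = zero
  hub₁ = suc zero
  hub₂ = suc (suc zero)

  leaf : Fin l → Fin (3 + l)
  leaf j = suc (suc (suc j))

  leaf-injective : ∀ {j j′} → leaf j ≡ leaf j′ → j ≡ j′
  leaf-injective refl = refl

  spine : Fin (3 + l) × Fin (3 + l) × Fin (3 + l)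
  spine = apex , hub₁ , hub₂

  page₁ page₂ : Fin l → Fin (3 + l) × Fin (3 + l) × Fin (3 + l)
  page₁ j = apex , hub₁ , leaf j
  page₂ j = apex , hub₂ , leaf j

module _ {l : ℕ} {P : Fin (3 + l) × Fin (3 + l) × Fin (3 + l) → Set} where

  Khat-All⁻ : All P (KhatTwo3 l) → P spine × (∀ j → P (page₁ j)) × (∀ j → P (page₂ j))
  Khat-All⁻ ps with p ∷ ps′ ← map⁻ ps = p , tabulate⁻ (++⁻ˡ _ ps′) , tabulate⁻ (++⁻ʳ _ ps′)

  Khat-All⁺ : P spine → (∀ j → P (page₁ j)) → (∀ j → P (page₂ j)) → All P (KhatTwo3 l)
  Khat-All⁺ p p₁ p₂ = map⁺ (p ∷ ++⁺ (tabulate⁺ p₁) (tabulate⁺ p₂))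

swapHubs : ∀ {l} → Fin (3 + l) → Fin (3 + l)
swapHubs zero                = zero
swapHubs (suc zero)          = suc (suc zero)
swapHubs (suc (suc zero))    = suc zero
swapHubs (suc (suc (suc j))) = suc (suc (suc j))

swapHubs-involutive : ∀ {l} (x : Fin (3 + l)) → swapHubs (swapHubs x) ≡ x
swapHubs-involutive zero                = refl
swapHubs-involutive (suc zero)          = refl
swapHubs-involutive (suc (suc zero))    = refl
swapHubs-involutive (suc (suc (suc j))) = refl

∘swapHubs-injective : ∀ {l} {ψ : Fin (3 + l) → ℕ} → Injective _≡_ _≡_ ψ →
  Injective _≡_ _≡_ (ψ ∘ swapHubs)
∘swapHubs-injective ψ-inj {x} {y} eq =
  trans (sym (swapHubs-involutive x)) (trans (cong swapHubs (ψ-inj eq)) (swapHubs-involutive y))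

Khat-swapHubs : ∀ {l ψ S} → MapsInto (KhatTwo3 l) ψ S → MapsInto (KhatTwo3 l) (ψ ∘ swapHubs) S
Khat-swapHubs maps with spine∈ , page₁∈ , page₂∈ ← Khat-All⁻ maps =
  Khat-All⁺ (∈E-resp swap₂₃ spine∈) page₂∈ page₁∈

insertAt-punchOut : ∀ {A : Set} {n} (xs : Fin n → A) {i x} v (i≢x : i ≢ x) →
  insertAt xs i v x ≡ xs (punchOut i≢x)
insertAt-punchOut xs {i} v i≢x =
  trans (sym (removeAt-punchOut (insertAt xs i v) i≢x)) (insertAt-punchIn xs i v (punchOut i≢x))

insertAt-injective : ∀ {A : Set} {n} {xs : Fin n → A} {v} → Injective _≡_ _≡_ xs → (∀ j → xs j ≢ v) →
  ∀ i → Injective _≡_ _≡_ (insertAt xs i v)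
insertAt-injective {xs = xs} {v} xs-inj fresh i {x} {y} eq with i Fin.≟ x | i Fin.≟ y
... | yes refl | yes refl = refl
... | yes refl | no  i≢y  =
  ⊥-elim (fresh _ (trans (sym (insertAt-punchOut xs v i≢y)) (trans (sym eq) (insertAt-lookup xs i v))))
... | no  i≢x  | yes refl =
  ⊥-elim (fresh _ (trans (sym (insertAt-punchOut xs v i≢x)) (trans eq (insertAt-lookup xs i v))))
... | no  i≢x  | no  i≢y  =
  punchOut-injective i≢x i≢y (xs-inj (trans (sym (insertAt-punchOut xs v i≢x)) (trans eq (insertAt-punchOut xs v i≢y))))

Khat-insertLeaf : ∀ {l ρ S w} → MapsInto (KhatTwo3 l) ρ S →
  (ρ apex , ρ hub₁ , w) ∈E S → (ρ apex , ρ hub₂ , w) ∈E S →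
  MapsInto (KhatTwo3 (suc l)) (insertAt ρ (leaf zero) w) S
Khat-insertLeaf maps new₁ new₂ with spine∈ , page₁∈ , page₂∈ ← Khat-All⁻ maps =
  Khat-All⁺ spine∈ (λ { zero → new₁ ; (suc j) → page₁∈ j }) (λ { zero → new₂ ; (suc j) → page₂∈ j })

Khat-removeLeaf : ∀ {l ψ S} (i : Fin (suc l)) → img ψ spine ∈E S →
  (∀ j → j ≢ i → img ψ (page₁ j) ∈E S) → (∀ j → j ≢ i → img ψ (page₂ j) ∈E S) →
  MapsInto (KhatTwo3 l) (removeAt ψ (leaf i)) S
Khat-removeLeaf i spine∈ page₁∈ page₂∈ =
  Khat-All⁺ spine∈ (λ j → page₁∈ _ (punchInᵢ≢i i j)) (λ j → page₂∈ _ (punchInᵢ≢i i j))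

-- Counting edges

module _ {A : Set} where

  count : {P : A → Set} → (∀ x → Dec (P x)) → List A → ℕ
  count P? = length ∘ filter P?

  count-∪ : ∀ {P Q : A → Set} (P? : ∀ x → Dec (P x)) (Q? : ∀ x → Dec (Q x)) → (∀ x → P x → ¬ Q x) →
    ∀ xs → count (λ x → P? x ⊎-dec Q? x) xs ≡ count P? xs + count Q? xs
  count-∪ P? Q? disjoint [] = refl
  count-∪ P? Q? disjoint (x ∷ xs) with P? x | Q? x
  ... | yes p | yes q = contradiction q (disjoint x p)
  ... | yes _ | no  _ = cong suc (count-∪ P? Q? disjoint xs)
  ... | no  _ | yes _ = trans (cong suc (count-∪ P? Q? disjoint xs)) (sym (+-suc _ _))
  ... | no  _ | no  _ = count-∪ P? Q? disjoint xs

module _ {c ℓ} (S : Setoid c ℓ) where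
  open Setoid S using (Carrier; _≈_) renaming (sym to ≈ˢ-sym; trans to ≈ˢ-trans)
  open import Data.List.Membership.Setoid S using (_∈_)

  injective-family-≤-length : ∀ {m xs} (f : Fin m → Carrier) → (∀ {i j} → f i ≈ f j → i ≡ j) →
    (∀ i → f i ∈ xs) → m ≤ length xs
  injective-family-≤-length {m} {xs} f f-inj f∈xs with m ≤? length xs
  ... | yes m≤ = m≤
  ... | no  m≰ with i , j , i<j , same-slot ← pigeonhole (≰⇒> m≰) (index ∘ f∈xs) =
    contradiction (f-inj (≈ˢ-trans (slot i) (≈ˢ-sym (subst (λ k → f j ≈ lookup xs k) (sym same-slot) (slot j)))))
                  (Fin.<⇒≢ i<j)
    where
    slot : ∀ k → f k ≈ lookup xs (index (f∈xs k))
    slot k = lookup-index (f∈xs k)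

family-≤-count : ∀ {m S} {P : Edge → Set} (P? : ∀ e → Dec (P e)) → (∀ {e f} → SameEdge e f → P e → P f) →
  (f : Fin m → Edge) → (∀ {i j} → SameEdge (f i) (f j) → i ≡ j) →
  (∀ i → f i ∈E S) → (∀ i → P (f i)) → m ≤ count P? S
family-≤-count P? resp f f-inj f∈S Pf =
  injective-family-≤-length edgeSetoid f f-inj (λ i → ∈-filter⁺ edgeSetoid P? resp (f∈S i) (Pf i))

fan-injective : ∀ {m n} {ρ : Fin n → ℕ} → Injective _≡_ _≡_ ρ →
  ∀ {p q} (f : Fin m → Fin n) → Injective _≡_ _≡_ f → (∀ i → f i ≢ p) → (∀ i → f i ≢ q) →
  ∀ {i j} → SameEdge (img ρ (p , q , f i)) (img ρ (p , q , f j)) → i ≡ j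
fan-injective ρ-inj f f-inj f≢p f≢q same with ∈₃-img⁻ ρ-inj (∈₃-resp same at₃)
... | inj₁ fi≡p         = ⊥-elim (f≢p _ fi≡p)
... | inj₂ (inj₁ fi≡q)  = ⊥-elim (f≢q _ fi≡q)
... | inj₂ (inj₂ fi≡fj) = f-inj fi≡fj

Joins : ℕ → ℕ → ℕ → Edge → Set
Joins x y z e = x ∈₃ e × y ∈₃ e × ¬ z ∈₃ e

Misses : ℕ → ℕ → ℕ → Edge → Set
Misses x y z e = ¬ z ∈₃ e × ¬ (x ∈₃ e × y ∈₃ e)

joins? : ∀ x y z e → Dec (Joins x y z e)
joins? x y z e = x ∈₃? e ×-dec (y ∈₃? e ×-dec ¬? (z ∈₃? e))

misses? : ∀ x y z e → Dec (Misses x y z e)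
misses? x y z e = ¬? (z ∈₃? e) ×-dec ¬? (x ∈₃? e ×-dec y ∈₃? e)

joins-resp : ∀ {x y z e f} → SameEdge e f → Joins x y z e → Joins x y z f
joins-resp e≈f (x∈ , y∈ , z∉) = ∈₃-resp e≈f x∈ , ∈₃-resp e≈f y∈ , z∉ ∘ ∈₃-resp (≈-sym e≈f)

misses-resp : ∀ {x y z e f} → SameEdge e f → Misses x y z e → Misses x y z f
misses-resp f≈e (z∉ , ¬both) =
  z∉ ∘ ∈₃-resp (≈-sym f≈e) , λ (x∈ , y∈) → ¬both (∈₃-resp (≈-sym f≈e) x∈ , ∈₃-resp (≈-sym f≈e) y∈)

-- A decidable shadow of a copy of K̂_{2,l}^{(3)} in A whose apex and first hub are c and b (in some
-- order) and which avoids a: its l + 1 edges through c and b, and its l edges through the second hub.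
Crowded : ℕ → List Edge → ℕ → ℕ → ℕ → Set
Crowded l A c a b = suc l ≤ count (joins? c b a) A × l ≤ count (misses? c b a) A

crowded? : ∀ l A c a b → Dec (Crowded l A c a b)
crowded? l A c a b = suc l ≤? count (joins? c b a) A ×-dec l ≤? count (misses? c b a) A

both-crowded : ∀ {l A c a b} → Crowded l A c a b → Crowded l A c b a → suc l + suc l + l ≤ length A
both-crowded {l} {A} {c} {a} {b} (joins-b , misses-b) (joins-a , _) = begin
  suc l + suc l + l                                         ≤⟨ +-mono-≤ (+-mono-≤ joins-b joins-a) misses-b ⟩
  count (joins? c b a) A + count (joins? c a b) A + count (misses? c b a) A
    ≡⟨ cong (_+ count (misses? c b a) A) (sym (count-∪ (joins? c b a) (joins? c a b) a-apart A)) ⟩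
  count joins-either A + count (misses? c b a) A            ≡⟨ sym (count-∪ joins-either (misses? c b a) excluded A) ⟩
  count (λ e → joins-either e ⊎-dec misses? c b a e) A      ≤⟨ length-filter _ A ⟩
  length A                                                  ∎
  where
  open ≤-Reasoning
  joins-either = λ e → joins? c b a e ⊎-dec joins? c a b e
  a-apart : ∀ e → Joins c b a e → ¬ Joins c a b e
  a-apart _ (_ , _ , a∉) (_ , a∈ , _) = a∉ a∈
  excluded : ∀ e → Joins c b a e ⊎ Joins c a b e → ¬ Misses c b a e
  excluded e (inj₁ (c∈ , b∈ , _)) (_ , ¬both) = ¬both (c∈ , b∈)
  excluded e (inj₂ (_ , a∈ , _))  (a∉ , _)    = a∉ a∈

module _ {A : List Edge} {c a b : ℕ} (c≢a : c ≢ a) (b≢a : b ≢ a) (cab∉A : (c , a , b) ∉E A) where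

  joins-of-pair : ∀ {x y z} → (x ≡ c × y ≡ b) ⊎ (x ≡ b × y ≡ c) → (x , y , z) ∈E A → Joins c b a (x , y , z)
  joins-of-pair (inj₁ (refl , refl)) xyz∈A =
    at₁ , at₂ , Sum.[ c≢a ∘ sym , Sum.[ b≢a ∘ sym , (λ { refl → cab∉A (∈E-resp swap₂₃ xyz∈A) }) ] ]
  joins-of-pair (inj₂ (refl , refl)) xyz∈A =
    at₂ , at₁ ,
    Sum.[ b≢a ∘ sym , Sum.[ c≢a ∘ sym , (λ { refl → cab∉A (∈E-resp (≈-trans swap₁₂ swap₂₃) xyz∈A) }) ] ]

  book⇒crowded : ∀ {l ρ} → Injective _≡_ _≡_ ρ → MapsInto (KhatTwo3 l) ρ A →
    (ρ apex ≡ c × ρ hub₁ ≡ b) ⊎ (ρ apex ≡ b × ρ hub₁ ≡ c) → Crowded l A c a b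
  book⇒crowded {l} {ρ} ρ-inj maps orientation =
    family-≤-count (joins? c b a) joins-resp through-hub₁
      (fan-injective ρ-inj (λ (i : Fin (suc l)) → suc (suc i)) (suc-injective ∘ suc-injective) (λ _ ()) (λ _ ()))
      through-hub₁∈A through-hub₁-joins ,
    family-≤-count (misses? c b a) misses-resp (img ρ ∘ page₂)
      (fan-injective ρ-inj leaf leaf-injective (λ _ ()) (λ _ ()))
      page₂∈A page₂-misses
    where
    spine∈A = proj₁ (Khat-All⁻ maps)
    page₁∈A = proj₁ (proj₂ (Khat-All⁻ maps))
    page₂∈A = proj₂ (proj₂ (Khat-All⁻ maps))

    through-hub₁ : Fin (suc l) → Edge
    through-hub₁ i = img ρ (apex , hub₁ , suc (suc i))

    through-hub₁∈A : ∀ i → through-hub₁ i ∈E A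
    through-hub₁∈A zero    = spine∈A
    through-hub₁∈A (suc j) = page₁∈A j

    through-hub₁-joins : ∀ i → Joins c b a (through-hub₁ i)
    through-hub₁-joins i = joins-of-pair orientation (through-hub₁∈A i)

    a∉-through : ∀ i → ¬ a ∈₃ through-hub₁ i
    a∉-through i = proj₂ (proj₂ (through-hub₁-joins i))

    hub₁∉page₂ : ∀ j → ¬ ρ hub₁ ∈₃ img ρ (page₂ j)
    hub₁∉page₂ j = ∉₃-img ρ-inj (λ ()) (λ ()) (λ ())

    page₂-misses : ∀ j → Misses c b a (img ρ (page₂ j))
    page₂-misses j = a∉ , ¬both orientation
      where
      a∉ : ¬ a ∈₃ img ρ (page₂ j)
      a∉ (inj₁ a≡apex)        = a∉-through zero (inj₁ a≡apex)
      a∉ (inj₂ (inj₁ a≡hub₂)) = a∉-through zero (inj₂ (inj₂ a≡hub₂))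
      a∉ (inj₂ (inj₂ a≡leaf)) = a∉-through (suc j) (inj₂ (inj₂ a≡leaf))
      ¬both : (ρ apex ≡ c × ρ hub₁ ≡ b) ⊎ (ρ apex ≡ b × ρ hub₁ ≡ c) →
        ¬ (c ∈₃ img ρ (page₂ j) × b ∈₃ img ρ (page₂ j))
      ¬both (inj₁ (_ , refl)) (_ , b∈) = hub₁∉page₂ j b∈
      ¬both (inj₂ (_ , refl)) (c∈ , _) = hub₁∉page₂ j c∈

-- P2's strategy

edge-bounded : ∀ {x y z M} → x < M → y < M → z < M → ∀ v → v ∈₃ (x , y , z) → v < M
edge-bounded x<M y<M z<M v at₁ = x<M
edge-bounded x<M y<M z<M v at₂ = y<M
edge-bounded x<M y<M z<M v at₃ = z<M

vertexSum : List Edge → ℕ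
vertexSum []                  = 0
vertexSum ((x , y , z) ∷ S) = x + y + z + vertexSum S

vertex≤vertexSum : ∀ {v e} S → e ∈E S → v ∈₃ e → v ≤ vertexSum S
vertex≤vertexSum ((x , y , z) ∷ S) (here e≈xyz) v∈e = ≤-trans (in-edge (∈₃-resp e≈xyz v∈e)) (m≤m+n _ (vertexSum S))
  where
  in-edge : ∀ {v} → v ∈₃ (x , y , z) → v ≤ x + y + z
  in-edge at₁ = ≤-trans (m≤m+n x y) (m≤m+n (x + y) z)
  in-edge at₂ = ≤-trans (m≤n+m y x) (m≤m+n (x + y) z)
  in-edge at₃ = m≤n+m z (x + y)
vertex≤vertexSum ((x , y , z) ∷ S) (there e∈S) v∈e = ≤-trans (vertex≤vertexSum S e∈S v∈e) (m≤n+m _ (x + y + z))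

K̂₂₄-simple : Simple (KhatTwo3 4)
K̂₂₄-simple = toWitness {a? = simple? (KhatTwo3 4)} _

module Blocking (A₀ B₀ : List Edge)
  (ρ : Fin 6 → ℕ) (ρ-inj : Injective _≡_ _≡_ ρ) (ρ-maps : MapsInto (KhatTwo3 3) ρ B₀)
  (disjoint : Disjoint A₀ B₀) (no-copy : ¬ HasCopy (KhatTwo3 4) A₀) (no-threat : ¬ Threat (KhatTwo3 4) A₀ B₀)
  (calm : ¬ Crowded 3 A₀ (ρ apex) (ρ hub₁) (ρ hub₂)) where

  c a b : ℕ
  c = ρ apex
  a = ρ hub₁
  b = ρ hub₂

  c≢a : c ≢ a
  c≢a = (λ ()) ∘ ρ-inj
  c≢b : c ≢ b
  c≢b = (λ ()) ∘ ρ-inj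
  a≢b : a ≢ b
  a≢b = (λ ()) ∘ ρ-inj

  -- Every vertex of the starting position is below M, so the vertices u j are fresh.
  M : ℕ
  M = suc (vertexSum (A₀ ++ B₀))

  u : ℕ → ℕ
  u j = M + j

  cab∈B₀ : (c , a , b) ∈E B₀
  cab∈B₀ = proj₁ (Khat-All⁻ ρ-maps)

  cab∉A₀ : (c , a , b) ∉E A₀
  cab∉A₀ cab∈A₀ with e∉B₀ , cab≈e ← All.lookupAny disjoint cab∈A₀ = e∉B₀ (∈E-resp cab≈e cab∈B₀)

  low-A₀ : ∀ {e v} → e ∈E A₀ → v ∈₃ e → v < M
  low-A₀ e∈A₀ = s≤s ∘ vertex≤vertexSum (A₀ ++ B₀) (++⁺ˡ e∈A₀)

  low-B₀ : ∀ {e v} → e ∈E B₀ → v ∈₃ e → v < M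
  low-B₀ e∈B₀ = s≤s ∘ vertex≤vertexSum (A₀ ++ B₀) (++⁺ʳ A₀ e∈B₀)

  ρ-low : ∀ x → ρ x < M
  ρ-low zero                = low-B₀ cab∈B₀ at₁
  ρ-low (suc zero)          = low-B₀ cab∈B₀ at₂
  ρ-low (suc (suc zero))    = low-B₀ cab∈B₀ at₃
  ρ-low (suc (suc (suc j))) = low-B₀ (proj₁ (proj₂ (Khat-All⁻ ρ-maps)) j) at₃

  c<M : c < M
  c<M = ρ-low apex
  a<M : a < M
  a<M = ρ-low hub₁
  b<M : b < M
  b<M = ρ-low hub₂

  u-high : ∀ {j} → M ≤ u j
  u-high = m≤m+n M _

  u≮M : ∀ {j} → ¬ u j < M
  u≮M u<M = <⇒≱ u<M u-high

  low≢u : ∀ {v} j → v < M → v ≢ u j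
  low≢u j v<M refl = u≮M v<M

  u∉low-edge : ∀ {x y j k} → x < M → y < M → j ≢ k → ¬ u k ∈₃ (x , y , u j)
  u∉low-edge {k = k} x<M y<M j≢k =
    Sum.[ low≢u k x<M ∘ sym , Sum.[ low≢u k y<M ∘ sym , j≢k ∘ sym ∘ +-cancelˡ-≡ M _ _ ] ]

  -- After k rounds P2 has claimed the threats (c, a, u j) for j < k, and P1 has blocked each by (c, b, u j).
  data Blocked : ℕ → List Edge → Set where
    []  : Blocked 0 A₀
    _∷_ : ∀ {k g A} → SameEdge g (c , b , u k) → Blocked k A → Blocked (suc k) (g ∷ A)

  claimed : ℕ → List Edge
  claimed zero    = B₀
  claimed (suc k) = (c , a , u k) ∷ claimed k

  blocked-∈ : ∀ {k A e} → Blocked k A → e ∈E A → e ∈E A₀ ⊎ ∃ λ j → j < k × SameEdge e (c , b , u j)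
  blocked-∈ []         e∈A₀        = inj₁ e∈A₀
  blocked-∈ (g≈ ∷ bl)  (here e≈g)  = inj₂ (_ , ≤-refl , ≈-trans e≈g g≈)
  blocked-∈ (g≈ ∷ bl)  (there e∈A) = Sum.map₂ (λ (j , j<k , e≈) → j , m≤n⇒m≤1+n j<k , e≈) (blocked-∈ bl e∈A)

  claimed-∈ : ∀ k {e} → e ∈E claimed k → e ∈E B₀ ⊎ ∃ λ j → j < k × SameEdge e (c , a , u j)
  claimed-∈ zero    e∈B₀        = inj₁ e∈B₀
  claimed-∈ (suc k) (here e≈)   = inj₂ (k , ≤-refl , e≈)
  claimed-∈ (suc k) (there e∈B) = Sum.map₂ (λ (j , j<k , e≈) → j , m≤n⇒m≤1+n j<k , e≈) (claimed-∈ k e∈B)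

  A₀⊆blocked : ∀ {k A e} → Blocked k A → e ∈E A₀ → e ∈E A
  A₀⊆blocked []        = λ e∈A₀ → e∈A₀
  A₀⊆blocked (_ ∷ bl)  = there ∘ A₀⊆blocked bl

  B₀⊆claimed : ∀ k {e} → e ∈E B₀ → e ∈E claimed k
  B₀⊆claimed zero    = λ e∈B₀ → e∈B₀
  B₀⊆claimed (suc k) = there ∘ B₀⊆claimed k

  low-edge : ∀ {k A e} → Blocked k A → (∀ v → v ∈₃ e → v < M) → e ∈E A → e ∈E A₀
  low-edge bl e-low e∈A with blocked-∈ bl e∈A
  ... | inj₁ e∈A₀          = e∈A₀
  ... | inj₂ (j , _ , e≈) = ⊥-elim (u≮M (e-low _ (∈₃-resp (≈-sym e≈) at₃)))

  u∉blocked : ∀ {k A e} → Blocked k A → e ∈E A → ¬ u k ∈₃ e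
  u∉blocked bl e∈A uk∈e with blocked-∈ bl e∈A
  ... | inj₁ e∈A₀            = u≮M (low-A₀ e∈A₀ uk∈e)
  ... | inj₂ (j , j<k , e≈) = u∉low-edge c<M b<M (<⇒≢ j<k) (∈₃-resp e≈ uk∈e)

  u∉claimed : ∀ k {e} → e ∈E claimed k → ¬ u k ∈₃ e
  u∉claimed k e∈B uk∈e with claimed-∈ k e∈B
  ... | inj₁ e∈B₀            = u≮M (low-B₀ e∈B₀ uk∈e)
  ... | inj₂ (j , j<k , e≈) = u∉low-edge c<M a<M (<⇒≢ j<k) (∈₃-resp e≈ uk∈e)

  threat-legal : ∀ {k A} → Blocked k A → Legal (c , a , u k) A (claimed k)
  threat-legal {k} bl =
    (c≢a , low≢u k c<M , low≢u k a<M) ,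
    (λ cau∈A → u∉blocked bl cau∈A at₃) ,
    (λ cau∈B → u∉claimed k cau∈B at₃)

  completion-legal : ∀ {k A g} → Blocked k A → ¬ SameEdge g (c , b , u k) →
    Legal (c , b , u k) (g ∷ A) (claimed (suc k))
  completion-legal {k} bl g≉ = (c≢b , low≢u k c<M , low≢u k b<M) , ∉gA , ∉claimed
    where
    ∉gA : (c , b , u k) ∉E (_ ∷ _)
    ∉gA (here cbu≈g)  = g≉ (≈-sym cbu≈g)
    ∉gA (there cbu∈A) = u∉blocked bl cbu∈A at₃
    ∉claimed : (c , b , u k) ∉E claimed (suc k)
    ∉claimed (here cbu≈cau) = Sum.[ c≢b ∘ sym , Sum.[ a≢b ∘ sym , low≢u k b<M ] ] (∈₃-resp cbu≈cau at₂)
    ∉claimed (there cbu∈B)  = u∉claimed k cbu∈B at₃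

  low-pair : ∀ {x y w} → x < M → y < M → x ≢ y → M ≤ w → SameEdge (x , y , w) (c , b , w) →
    (x ≡ c × y ≡ b) ⊎ (x ≡ b × y ≡ c)
  low-pair x<M y<M x≢y w-high xyw≈ with ∈₃-resp xyw≈ at₁ | ∈₃-resp xyw≈ at₂
  ... | at₃              | _                = ⊥-elim (<⇒≱ x<M w-high)
  ... | _                | at₃              = ⊥-elim (<⇒≱ y<M w-high)
  ... | inj₁ x≡c         | inj₂ (inj₁ y≡b)  = inj₁ (x≡c , y≡b)
  ... | inj₂ (inj₁ x≡b)  | inj₁ y≡c         = inj₂ (x≡b , y≡c)
  ... | inj₁ x≡c         | inj₁ y≡c         = ⊥-elim (x≢y (trans x≡c (sym y≡c)))
  ... | inj₂ (inj₁ x≡b)  | inj₂ (inj₁ y≡b)  = ⊥-elim (x≢y (trans x≡b (sym y≡b)))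

  module _ {k A g} (bl : Blocked k A) (g∉A₀ : g ∉E A₀) (g∉B₀ : g ∉E B₀) where

    high-edge : ∀ {w e} → M ≤ w → w ∈₃ e → e ∈E (g ∷ A) → SameEdge e g ⊎ SameEdge e (c , b , w)
    high-edge w-high w∈e (here e≈g)  = inj₁ e≈g
    high-edge w-high w∈e (there e∈A) with blocked-∈ bl e∈A
    ... | inj₁ e∈A₀ = ⊥-elim (<⇒≱ (low-A₀ e∈A₀ w∈e) w-high)
    ... | inj₂ (j , _ , e≈) with ∈₃-resp e≈ w∈e
    ...   | at₁ = ⊥-elim (<⇒≱ c<M w-high)
    ...   | at₂ = ⊥-elim (<⇒≱ b<M w-high)
    ...   | at₃ = inj₂ e≈

    low-edge-≉g : ∀ {w e} → w ∈₃ g → ¬ w ∈₃ e → (∀ v → v ∈₃ e → v < M) → e ∈E (g ∷ A) → e ∈E A₀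
    low-edge-≉g w∈g w∉e e-low (here e≈g)  = ⊥-elim (w∉e (∈₃-resp (≈-sym e≈g) w∈g))
    low-edge-≉g w∈g w∉e e-low (there e∈A) = low-edge bl e-low e∈A

    -- By high-edge, a vertex ≥ M has degree at most two in g ∷ A.
    low-if-three : ∀ {v e₁ e₂ e₃} →
      v ∈₃ e₁ × e₁ ∈E (g ∷ A) → v ∈₃ e₂ × e₂ ∈E (g ∷ A) → v ∈₃ e₃ × e₃ ∈E (g ∷ A) →
      ¬ SameEdge e₁ e₂ → ¬ SameEdge e₁ e₃ → ¬ SameEdge e₂ e₃ → v < M
    low-if-three {v} (v∈₁ , ∈₁) (v∈₂ , ∈₂) (v∈₃ , ∈₃) ₁≉₂ ₁≉₃ ₂≉₃ with v <? M
    ... | yes v<M = v<M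
    ... | no  v≮M
      with high-edge (≮⇒≥ v≮M) v∈₁ ∈₁ | high-edge (≮⇒≥ v≮M) v∈₂ ∈₂ | high-edge (≮⇒≥ v≮M) v∈₃ ∈₃
    ...   | inj₁ ₁≈ | inj₁ ₂≈ | _       = ⊥-elim (₁≉₂ (≈-trans ₁≈ (≈-sym ₂≈)))
    ...   | inj₂ ₁≈ | inj₂ ₂≈ | _       = ⊥-elim (₁≉₂ (≈-trans ₁≈ (≈-sym ₂≈)))
    ...   | inj₁ ₁≈ | inj₂ _  | inj₁ ₃≈ = ⊥-elim (₁≉₃ (≈-trans ₁≈ (≈-sym ₃≈)))
    ...   | inj₂ ₁≈ | inj₁ _  | inj₂ ₃≈ = ⊥-elim (₁≉₃ (≈-trans ₁≈ (≈-sym ₃≈)))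
    ...   | inj₁ _  | inj₂ ₂≈ | inj₂ ₃≈ = ⊥-elim (₂≉₃ (≈-trans ₂≈ (≈-sym ₃≈)))
    ...   | inj₂ _  | inj₁ ₂≈ | inj₁ ₃≈ = ⊥-elim (₂≉₃ (≈-trans ₂≈ (≈-sym ₃≈)))

    module _ {ψ : Fin 7 → ℕ} (ψ-inj : Injective _≡_ _≡_ ψ) (ψ-maps : MapsInto (KhatTwo3 4) ψ (g ∷ A)) where

      spine∈ : img ψ spine ∈E (g ∷ A)
      spine∈ = proj₁ (Khat-All⁻ ψ-maps)
      page₁∈ : ∀ j → img ψ (page₁ j) ∈E (g ∷ A)
      page₁∈ = proj₁ (proj₂ (Khat-All⁻ ψ-maps))
      page₂∈ : ∀ j → img ψ (page₂ j) ∈E (g ∷ A)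
      page₂∈ = proj₂ (proj₂ (Khat-All⁻ ψ-maps))

      apex-low : ψ apex < M
      apex-low = low-if-three (at₁ , spine∈) (at₁ , page₁∈ zero) (at₁ , page₁∈ (suc zero))
        (apart ψ-inj spine (page₁ zero)) (apart ψ-inj spine (page₁ (suc zero))) (apart ψ-inj (page₁ zero) (page₁ (suc zero)))

      hub₁-low : ψ hub₁ < M
      hub₁-low = low-if-three (at₂ , spine∈) (at₂ , page₁∈ zero) (at₂ , page₁∈ (suc zero))
        (apart ψ-inj spine (page₁ zero)) (apart ψ-inj spine (page₁ (suc zero))) (apart ψ-inj (page₁ zero) (page₁ (suc zero)))

      hub₂-low : ψ hub₂ < M
      hub₂-low = low-if-three (at₃ , spine∈) (at₂ , page₂∈ zero) (at₂ , page₂∈ (suc zero))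
        (apart ψ-inj spine (page₂ zero)) (apart ψ-inj spine (page₂ (suc zero))) (apart ψ-inj (page₂ zero) (page₂ (suc zero)))

      pages-apart : ∀ i → ¬ SameEdge (img ψ (page₁ i)) (img ψ (page₂ i))
      pages-apart i = separatedBy at₂ (∉₃-img ψ-inj (λ ()) (λ ()) (λ ()))

      leaf-pages : ∀ i → M ≤ ψ (leaf i) →
        SameEdge (img ψ (page₁ i)) (c , b , ψ (leaf i)) × SameEdge (img ψ (page₂ i)) g ⊎
        SameEdge (img ψ (page₁ i)) g × SameEdge (img ψ (page₂ i)) (c , b , ψ (leaf i))
      leaf-pages i high with high-edge high at₃ (page₁∈ i) | high-edge high at₃ (page₂∈ i)
      ... | inj₁ p₁≈g  | inj₁ p₂≈g  = ⊥-elim (pages-apart i (≈-trans p₁≈g (≈-sym p₂≈g)))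
      ... | inj₂ p₁≈cb | inj₁ p₂≈g  = inj₁ (p₁≈cb , p₂≈g)
      ... | inj₁ p₁≈g  | inj₂ p₂≈cb = inj₂ (p₁≈g , p₂≈cb)
      ... | inj₂ p₁≈cb | inj₂ p₂≈cb = ⊥-elim (pages-apart i (≈-trans p₁≈cb (≈-sym p₂≈cb)))

      all-leaves-low-impossible : (∀ j → ψ (leaf j) < M) → ⊥
      all-leaves-low-impossible leaves-low =
        Sum.[ no-copy , no-threat ] (completion-is-threat K̂₂₄-simple g∉A₀ g∉B₀ ψ-inj (All.map into-A₀ ψ-maps))
        where
        ψ-low : ∀ x → ψ x < M
        ψ-low zero                = apex-low
        ψ-low (suc zero)          = hub₁-low
        ψ-low (suc (suc zero))    = hub₂-low
        ψ-low (suc (suc (suc j))) = leaves-low j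
        into-A₀ : ∀ {t} → img ψ t ∈E (g ∷ A) → img ψ t ∈E (g ∷ A₀)
        into-A₀     (here t≈g)  = here t≈g
        into-A₀ {t} (there t∈A) = there (low-edge bl (edge-bounded (ψ-low _) (ψ-low _) (ψ-low _)) t∈A)

      -- Deleting the high leaf leaves a copy of K̂_{2,3}^{(3)} in A₀ whose apex and first hub are c and b.
      high-leaf-impossible : ∀ i → M ≤ ψ (leaf i) →
        SameEdge (img ψ (page₁ i)) (c , b , ψ (leaf i)) → SameEdge (img ψ (page₂ i)) g → ⊥
      high-leaf-impossible i high p₁≈cbw p₂≈g =
        calm (book⇒crowded c≢a (a≢b ∘ sym) cab∉A₀ (punchIn-injective (leaf i) _ _ ∘ ψ-inj)
               (Khat-removeLeaf {ψ = ψ} i spine∈A₀ page₁∈A₀ page₂∈A₀)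
               (low-pair apex-low hub₁-low ((λ ()) ∘ ψ-inj) high p₁≈cbw))
        where
        w∈g : ψ (leaf i) ∈₃ g
        w∈g = ∈₃-resp p₂≈g at₃

        w∉page : ∀ {h} j → j ≢ i → h ≢ leaf i → ¬ ψ (leaf i) ∈₃ img ψ (apex , h , leaf j)
        w∉page j j≢i h≢ = ∉₃-img ψ-inj (λ ()) (h≢ ∘ sym) (j≢i ∘ sym ∘ leaf-injective)

        other-leaf-low : ∀ j → j ≢ i → ψ (leaf j) < M
        other-leaf-low j j≢i with ψ (leaf j) <? M
        ... | yes low = low
        ... | no  ≮M with leaf-pages j (≮⇒≥ ≮M)
        ...   | inj₁ (_ , q₂≈g) = ⊥-elim (w∉page j j≢i (λ ()) (∈₃-resp (≈-sym q₂≈g) w∈g))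
        ...   | inj₂ (q₁≈g , _) = ⊥-elim (w∉page j j≢i (λ ()) (∈₃-resp (≈-sym q₁≈g) w∈g))

        spine∈A₀ : img ψ spine ∈E A₀
        spine∈A₀ =
          low-edge-≉g w∈g (∉₃-img ψ-inj (λ ()) (λ ()) (λ ())) (edge-bounded apex-low hub₁-low hub₂-low) spine∈

        page₁∈A₀ : ∀ j → j ≢ i → img ψ (page₁ j) ∈E A₀
        page₁∈A₀ j j≢i =
          low-edge-≉g w∈g (w∉page j j≢i (λ ())) (edge-bounded apex-low hub₁-low (other-leaf-low j j≢i)) (page₁∈ j)

        page₂∈A₀ : ∀ j → j ≢ i → img ψ (page₂ j) ∈E A₀
        page₂∈A₀ j j≢i =
          low-edge-≉g w∈g (w∉page j j≢i (λ ())) (edge-bounded apex-low hub₂-low (other-leaf-low j j≢i)) (page₂∈ j)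

    no-completion : ¬ HasCopy (KhatTwo3 4) (g ∷ A)
    no-completion (ψ , ψ-inj , ψ-maps) with any? (λ i → M ≤? ψ (leaf i))
    ... | no  no-high-leaf = all-leaves-low-impossible ψ-inj ψ-maps (λ i → ≰⇒> (no-high-leaf ∘ (i ,_)))
    ... | yes (i , high) with leaf-pages ψ-inj ψ-maps i high
    ...   | inj₁ (p₁≈cbw , p₂≈g) = high-leaf-impossible ψ-inj ψ-maps i high p₁≈cbw p₂≈g
    ...   | inj₂ (p₁≈g , p₂≈cbw) =
      high-leaf-impossible (∘swapHubs-injective ψ-inj) (Khat-swapHubs ψ-maps) i high p₂≈cbw p₁≈g

  completes : ∀ k → HasCopy (KhatTwo3 4) ((c , b , u k) ∷ claimed (suc k))
  completes k =
    insertAt ρ (leaf zero) (u k) ,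
    insertAt-injective ρ-inj (λ x → low≢u k (ρ-low x)) (leaf zero) ,
    Khat-insertLeaf (All.map (there ∘ there ∘ B₀⊆claimed k) ρ-maps) (there (here ≈-refl)) (here ≈-refl)

  respond : ℕ → List Edge → Edge
  respond zero    A = c , a , u zero
  respond (suc k) A = if does ((c , b , u k) ∈? A) then (c , a , u (suc k)) else (c , b , u k)

  σ : StrategyP2
  σ A B = respond (length B ∸ length B₀) A

  claimed-length : ∀ k → length (claimed k) ≡ k + length B₀
  claimed-length zero    = refl
  claimed-length (suc k) = cong suc (claimed-length k)

  rounds : ∀ k → length (claimed k) ∸ length B₀ ≡ k
  rounds k = trans (cong (_∸ length B₀) (claimed-length k)) (m+n∸n≡m k (length B₀))

  respond-∈ : ∀ {k A} → (c , b , u k) ∈E A → respond (suc k) A ≡ (c , a , u (suc k))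
  respond-∈ {k} {A} cbu∈A with (c , b , u k) ∈? A
  ... | yes _     = refl
  ... | no  cbu∉A = contradiction cbu∈A cbu∉A

  respond-∉ : ∀ {k A} → (c , b , u k) ∉E A → respond (suc k) A ≡ (c , b , u k)
  respond-∉ {k} {A} cbu∉A with (c , b , u k) ∈? A
  ... | yes cbu∈A = contradiction cbu∈A cbu∉A
  ... | no  _     = refl

  σ-blocked : ∀ {k A} → Blocked k A → σ A (claimed k) ≡ (c , a , u k)
  σ-blocked {k} {A} bl = trans (cong (λ r → respond r A) (rounds k)) (respond-blocked bl)
    where
    respond-blocked : ∀ {k A} → Blocked k A → respond k A ≡ (c , a , u k)
    respond-blocked []                  = refl
    respond-blocked {A = g ∷ A} (g≈ ∷ _) = respond-∈ {A = g ∷ A} (here (≈-sym g≈))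

  σ-unblocked : ∀ {k A g} → Blocked k A → ¬ SameEdge g (c , b , u k) →
    σ (g ∷ A) (claimed (suc k)) ≡ (c , b , u k)
  σ-unblocked {k} {A} {g} bl g≉ =
    trans (cong (λ r → respond r (g ∷ A)) (rounds (suc k))) (respond-∉ (proj₁ (proj₂ (completion-legal bl g≉))))

  data Stage : List Edge → List Edge → Set where
    blocked   : ∀ {k A} → Blocked k A → Stage A (claimed k)
    unblocked : ∀ {k A g} → Blocked k A → ¬ SameEdge g (c , b , u k) → Stage (g ∷ A) (claimed (suc k))

  stage-of : ∀ {A B} → Reach (KhatTwo3 4) σ A₀ B₀ A B → Stage A B
  stage-of start = blocked []
  stage-of (step f reach p2-missed _ _) with stage-of reach
  ... | blocked {k} bl rewrite σ-blocked bl with sameEdge? f (c , b , u k)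
  ...   | yes f≈ = blocked (f≈ ∷ bl)
  ...   | no  f≉ = unblocked bl f≉
  stage-of (step f reach p2-missed _ _) | unblocked {k} bl g≉ =
    ⊥-elim (p2-missed (subst (λ e → HasCopy (KhatTwo3 4) (e ∷ claimed (suc k))) (sym (σ-unblocked bl g≉))
                             (completes k)))

  stage-draws : ∀ {A B} → Stage A B → Legal (σ A B) A B ×
    (¬ HasCopy (KhatTwo3 4) (σ A B ∷ B) → ∀ f → Legal f A (σ A B ∷ B) → ¬ HasCopy (KhatTwo3 4) (f ∷ A))
  stage-draws (blocked {k} bl) rewrite σ-blocked bl =
    threat-legal bl ,
    λ _ f (_ , f∉A , f∉B) → no-completion bl (f∉A ∘ A₀⊆blocked bl) (f∉B ∘ there ∘ B₀⊆claimed k)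
  stage-draws (unblocked {k} bl g≉) rewrite σ-unblocked bl g≉ =
    completion-legal bl g≉ , λ p2-missed → ⊥-elim (p2-missed (completes k))

  drawing-strategy : Σ StrategyP2 λ σ → DrawingStrategyP2 (KhatTwo3 4) σ A₀ B₀
  drawing-strategy = σ , λ A B reach → stage-draws (stage-of reach)

corollary3p3 : (A B : List Edge)
    → PositionP2ToMove (KhatTwo3 4) A B
    → HasCopy (KhatTwo3 3) B
    → length A ≤ 10
    → ¬ Threat (KhatTwo3 4) A B
    → Σ StrategyP2 (λ σ → DrawingStrategyP2 (KhatTwo3 4) σ A B)
corollary3p3 A B (_ , _ , disjoint , _ , no-copy , _) (ρ , ρ-inj , ρ-maps) |A|≤10 no-threat
  with crowded? 3 A (ρ apex) (ρ hub₁) (ρ hub₂) | crowded? 3 A (ρ apex) (ρ hub₂) (ρ hub₁)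
... | no calm | _       = Blocking.drawing-strategy A B ρ ρ-inj ρ-maps disjoint no-copy no-threat calm
... | yes _   | no calm =
  Blocking.drawing-strategy A B (ρ ∘ swapHubs) (∘swapHubs-injective ρ-inj) (Khat-swapHubs ρ-maps)
    disjoint no-copy no-threat calm
... | yes crowded | yes crowded′ =
  ⊥-elim (<⇒≱ (s≤s |A|≤10) (both-crowded {A = A} {ρ apex} {ρ hub₁} {ρ hub₂} crowded crowded′))
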